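{- There are infinitely many rational numbers $x$ such that $x$ has at least nine different representations of the form $$x=\sum_{i=1}^{\infty}\frac{a_{i}}{2^{a_{i}}},$$ where $(a_i)_{i\geq 1}$ is a strictly increasing sequence of positive integers.
   Context: Two representations are different if the corresponding strictly increasing sequences $(a_i)$ differ. -}

module Defs where

open import Data.Nat as ℕ using (ℕ; zero; suc; _^_)
open import Data.Nat.Properties using (m^n≢0)
open import Data.Integer using (+_)
open import Data.Rational using (ℚ; 0ℚ; _+_; _-_; ∣_∣; _<_; _/_)
open import Data.Product using (Σ; ∃; _×_; ∃-syntax)
open import Data.Fin using (Fin)
open import Relation.Binary.PropositionalEquality using (_≡_; _≢_)
open import Data.List using (List)
open import Data.List.Membership.Propositional using (_∉_)

term : ℕ → ℚ
term a = (+ a) / (2 ^ a)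
  where instance _ = m^n≢0 2 a

partialSum : (ℕ → ℕ) → ℕ → ℚ
partialSum a zero = 0ℚ
partialSum a (suc n) = partialSum a n + term (a n)

SeriesSumsTo : (ℕ → ℕ) → ℚ → Set
SeriesSumsTo a x =
  (ε : ℚ) → 0ℚ < ε → ∃[ N ] ((n : ℕ) → N ℕ.≤ n → ∣ partialSum a n - x ∣ < ε)

-- a (0-indexed) strictly increasing sequence of positive integers
StrictlyIncPos : (ℕ → ℕ) → Set
StrictlyIncPos a = (1 ℕ.≤ a 0) × ((i : ℕ) → a i ℕ.< a (suc i))

IsRepresentation : ℚ → (ℕ → ℕ) → Set
IsRepresentation x a = StrictlyIncPos a × SeriesSumsTo a x

Differ : (ℕ → ℕ) → (ℕ → ℕ) → Set
Differ a b = ∃[ i ] (a i ≢ b i)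

HasNineReps : ℚ → Set
HasNineReps x =
  Σ (Fin 9 → ℕ → ℕ) λ r →
    ((j : Fin 9) → IsRepresentation x (r j)) ×
    ((j k : Fin 9) → j ≢ k → Differ (r j) (r k))

InfinitelyMany : (ℚ → Set) → Set
InfinitelyMany P = (xs : List ℚ) → ∃[ x ] (x ∉ xs × P x)

-- The tail sums have the closed form Σ_{i ≥ N} i / 2^i = (2N + 2) / 2^N. Hence if F is a
-- strictly increasing list of positive integers below N, the sequence F, N, N + 1, N + 2, …
-- represents Σ_{a ∈ F} a / 2^a + (2N + 2) / 2^N. There are nine lists below 15 with the
-- same value S of Σ a / 2^a, so every x = S + (2N + 2) / 2^N with N ≥ 15 has nine
-- representations, and these x are pairwise distinct because the tail sums strictly decrease.
module Submission where

open import Data.Empty using (⊥-elim)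
open import Data.Fin as Fin using (Fin)
import Data.Fin.Properties as FinP
open import Data.Integer as ℤ using (+_)
import Data.Integer.Properties as ℤP
open import Data.List using (List; []; _∷_; length; _∷ʳ_)
open import Data.List.Membership.Propositional using (_∉_)
import Data.List.Properties as ListP
open import Data.List.Relation.Unary.Any using (here; there)
open import Data.List.Relation.Unary.Linked as Linked using (Linked; []; [-]; _∷_)
open import Data.Nat as ℕ using (ℕ; zero; suc; _^_; NonZero)
import Data.Nat.Properties as ℕP
open import Data.Nat.Tactic.RingSolver using (solve-∀)
open import Data.Product using (_,_; _×_; ∃-syntax)
open import Data.Rational as ℚ using (ℚ; 0ℚ; mkℚ; _+_; _-_; _<_; _≤_; _/_; ∣_∣; toℚᵘ)
import Data.Rational.Properties as ℚP
import Data.Rational.Unnormalised as ℚᵘ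
import Data.Rational.Unnormalised.Properties as ℚᵘP
open import Data.Sum using (inj₁; inj₂)
import Data.Vec as Vec
open import Function using (_∘_)
open import Relation.Binary.Definitions using (DecidableEquality; tri<; tri≈; tri>)
open import Relation.Binary.PropositionalEquality
open import Relation.Nullary using (yes; no; ¬?; _→-dec_)
open import Relation.Nullary.Decidable using (toWitness)

open import Defs
open import Algebra.Properties.AbelianGroup ℚP.+-0-abelianGroup
  using (⁻¹-anti-homo‿-; x≈z//y; ∙-cancelˡ)

toℚᵘ-/ : ∀ a m .{{_ : NonZero m}} → toℚᵘ (+ a / m) ℚᵘ.≃ (+ a ℚᵘ./ m)
toℚᵘ-/ a (suc m) = ℚP.toℚᵘ-fromℚᵘ (ℚᵘ.mkℚᵘ (+ a) m)

/-≡-by-cross : ∀ a b m n .{{_ : NonZero m}} .{{_ : NonZero n}} →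
               a ℕ.* n ≡ b ℕ.* m → + a / m ≡ + b / n
/-≡-by-cross a b (suc m) (suc n) eq =
  ℚP.fromℚᵘ-cong {ℚᵘ.mkℚᵘ (+ a) m} {ℚᵘ.mkℚᵘ (+ b) n} (ℚᵘ.*≡* (begin
    + a ℤ.* + suc n  ≡⟨ ℤP.pos-* a (suc n) ⟨
    + (a ℕ.* suc n)  ≡⟨ cong +_ eq ⟩
    + (b ℕ.* suc m)  ≡⟨ ℤP.pos-* b (suc m) ⟩
    + b ℤ.* + suc m  ∎))
  where open ≡-Reasoning

/-<-by-cross : ∀ a b m n .{{_ : NonZero m}} .{{_ : NonZero n}} →
               a ℕ.* n ℕ.< b ℕ.* m → + a / m < + b / n
/-<-by-cross a b m@(suc _) n@(suc _) lt = ℚP.toℚᵘ-cancel-<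
  (ℚᵘP.<-respˡ-≃ (ℚᵘP.≃-sym (toℚᵘ-/ a m)) (ℚᵘP.<-respʳ-≃ (ℚᵘP.≃-sym (toℚᵘ-/ b n))
    (ℚᵘ.*<* (subst₂ ℤ._<_ (ℤP.pos-* a n) (ℤP.pos-* b m) (ℤ.+<+ lt)))))

/-+-/ : ∀ a b m n .{{_ : NonZero m}} .{{_ : NonZero n}} →
        + a / m + + b / n ≡ (+ (a ℕ.* n ℕ.+ b ℕ.* m) / (m ℕ.* n)) {{ℕP.m*n≢0 m n}}
/-+-/ a b m@(suc _) n@(suc _) = ℚP.toℚᵘ-injective (begin
  toℚᵘ (+ a / m + + b / n)                    ≈⟨ ℚP.toℚᵘ-homo-+ (+ a / m) (+ b / n) ⟩
  toℚᵘ (+ a / m) ℚᵘ.+ toℚᵘ (+ b / n)          ≈⟨ ℚᵘP.+-cong (toℚᵘ-/ a m) (toℚᵘ-/ b n) ⟩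
  + a ℚᵘ./ m ℚᵘ.+ + b ℚᵘ./ n                  ≡⟨ cong (ℚᵘ._/ (m ℕ.* n)) numerator ⟩
  + (a ℕ.* n ℕ.+ b ℕ.* m) ℚᵘ./ (m ℕ.* n)      ≈⟨ toℚᵘ-/ (a ℕ.* n ℕ.+ b ℕ.* m) (m ℕ.* n) ⟨
  toℚᵘ (+ (a ℕ.* n ℕ.+ b ℕ.* m) / (m ℕ.* n))  ∎)
  where
  open ℚᵘP.≃-Reasoning
  numerator : + a ℤ.* + n ℤ.+ + b ℤ.* + m ≡ + (a ℕ.* n ℕ.+ b ℕ.* m)
  numerator = trans (sym (cong₂ ℤ._+_ (ℤP.pos-* a n) (ℤP.pos-* b m)))
                    (sym (ℤP.pos-+ (a ℕ.* n) (b ℕ.* m)))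

p+q≡r⇒∣p-r∣≡q : ∀ {p q r} → p + q ≡ r → 0ℚ ≤ q → ∣ p - r ∣ ≡ q
p+q≡r⇒∣p-r∣≡q {p} {q} {r} p+q≡r 0≤q = begin
  ∣ p - r ∣        ≡⟨ ℚP.∣-p∣≡∣p∣ (p - r) ⟨
  ∣ ℚ.- (p - r) ∣  ≡⟨ cong ∣_∣ (⁻¹-anti-homo‿- p r) ⟩
  ∣ r - p ∣        ≡⟨ cong ∣_∣ (x≈z//y q p r (trans (ℚP.+-comm q p) p+q≡r)) ⟨
  ∣ q ∣            ≡⟨ ℚP.0≤p⇒∣p∣≡p 0≤q ⟩
  q                ∎
  where open ≡-Reasoning

-- Stated with ℚ._+_ rather than the group operation, so that applying it to concrete
-- rationals does not unfold _+_.
+-cancelˡ : ∀ p q r → p + q ≡ p + r → q ≡ r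
+-cancelˡ = ∙-cancelˡ

module _ (f : ℕ → ℚ) (step : ∀ n → f (suc n) < f n) where

  strictlyDecreasing : ∀ {m n} → m ℕ.< n → f n < f m
  strictlyDecreasing {m} {suc n} m<1+n with ℕP.m<1+n⇒m<n∨m≡n m<1+n
  ... | inj₁ m<n  = ℚP.<-trans (step n) (strictlyDecreasing m<n)
  ... | inj₂ refl = step m

  strictlyDecreasing⇒injective : ∀ {m n} → f m ≡ f n → m ≡ n
  strictlyDecreasing⇒injective {m} {n} fm≡fn with ℕP.<-cmp m n
  ... | tri< m<n _ _ = ⊥-elim (ℚP.<-irrefl (sym fm≡fn) (strictlyDecreasing m<n))
  ... | tri≈ _ m≡n _ = m≡n
  ... | tri> _ _ n<m = ⊥-elim (ℚP.<-irrefl fm≡fn (strictlyDecreasing n<m))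

module _ {a} {A : Set a} (_≟_ : DecidableEquality A) where

  -- The even and the odd values of f cannot both hit y.
  injective⇒avoids : (f : ℕ → A) → (∀ {m n} → f m ≡ f n → m ≡ n) →
                     (xs : List A) → ∃[ n ] f n ∉ xs
  injective⇒avoids f inj []       = 0 , λ ()
  injective⇒avoids f inj (y ∷ ys)
    with injective⇒avoids (f ∘ (2 ℕ.*_)) (ℕP.*-cancelˡ-≡ _ _ 2 ∘ inj) ys
       | injective⇒avoids (f ∘ suc ∘ (2 ℕ.*_)) (ℕP.*-cancelˡ-≡ _ _ 2 ∘ ℕP.suc-injective ∘ inj) ys
  ... | m , f[2m]∉ys | n , f[1+2n]∉ys with f (2 ℕ.* m) ≟ y
  ...   | no f[2m]≢y = 2 ℕ.* m , λ
    { (here f[2m]≡y)    → f[2m]≢y f[2m]≡y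
    ; (there f[2m]∈ys)  → f[2m]∉ys f[2m]∈ys }
  ...   | yes f[2m]≡y = suc (2 ℕ.* n) , λ
    { (here f[1+2n]≡y)   → ℕP.even≢odd m n (inj (trans f[2m]≡y (sym f[1+2n]≡y)))
    ; (there f[1+2n]∈ys) → f[1+2n]∉ys f[1+2n]∈ys }

1+n≤2^n : ∀ n → suc n ℕ.≤ 2 ^ n
1+n≤2^n zero    = ℕ.s≤s ℕ.z≤n
1+n≤2^n (suc n) = ℕP.+-mono-≤ (ℕP.≤-trans (ℕ.s≤s ℕ.z≤n) (1+n≤2^n n))
                              (ℕP.≤-trans (1+n≤2^n n) (ℕP.≤-reflexive (sym (ℕP.+-identityʳ (2 ^ n)))))

-- At k = 8q because (16q + 2) q < (4q + 1)² ≤ 2^(8q); beyond, the left side at most doubles per step.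
[2k+2]*q<2^k : ∀ q k → 8 ℕ.* q ℕ.≤ k → (2 ℕ.* k ℕ.+ 2) ℕ.* q ℕ.< 2 ^ k
[2k+2]*q<2^k q k 8q≤k =
  subst (λ k → (2 ℕ.* k ℕ.+ 2) ℕ.* q ℕ.< 2 ^ k) (ℕP.m∸n+n≡m 8q≤k) (from8q (k ℕ.∸ 8 ℕ.* q))
  where
  open ℕP.≤-Reasoning
  square : ∀ q → suc (4 ℕ.* q) ℕ.* suc (4 ℕ.* q) ≡ (2 ℕ.* (8 ℕ.* q) ℕ.+ 2) ℕ.* q ℕ.+ suc (6 ℕ.* q)
  square = solve-∀
  eight : ∀ q → 4 ℕ.* q ℕ.+ 4 ℕ.* q ≡ 8 ℕ.* q
  eight = solve-∀
  double : ∀ k q → 2 ℕ.* ((2 ℕ.* k ℕ.+ 2) ℕ.* q) ≡ (2 ℕ.* suc k ℕ.+ 2) ℕ.* q ℕ.+ 2 ℕ.* k ℕ.* q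
  double = solve-∀
  from8q : ∀ t → (2 ℕ.* (t ℕ.+ 8 ℕ.* q) ℕ.+ 2) ℕ.* q ℕ.< 2 ^ (t ℕ.+ 8 ℕ.* q)
  from8q zero = begin-strict
    (2 ℕ.* (8 ℕ.* q) ℕ.+ 2) ℕ.* q                     <⟨ ℕP.m<m+n _ ℕ.z<s ⟩
    (2 ℕ.* (8 ℕ.* q) ℕ.+ 2) ℕ.* q ℕ.+ suc (6 ℕ.* q)  ≡⟨ square q ⟨
    suc (4 ℕ.* q) ℕ.* suc (4 ℕ.* q)                   ≤⟨ ℕP.*-mono-≤ (1+n≤2^n (4 ℕ.* q)) (1+n≤2^n (4 ℕ.* q)) ⟩
    2 ^ (4 ℕ.* q) ℕ.* 2 ^ (4 ℕ.* q)                   ≡⟨ ℕP.^-distribˡ-+-* 2 (4 ℕ.* q) (4 ℕ.* q) ⟨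
    2 ^ (4 ℕ.* q ℕ.+ 4 ℕ.* q)                         ≡⟨ cong (2 ^_) (eight q) ⟩
    2 ^ (8 ℕ.* q)                                     ∎
  from8q (suc t) = begin-strict
    (2 ℕ.* suc m ℕ.+ 2) ℕ.* q                    ≤⟨ ℕP.m≤m+n _ (2 ℕ.* m ℕ.* q) ⟩
    (2 ℕ.* suc m ℕ.+ 2) ℕ.* q ℕ.+ 2 ℕ.* m ℕ.* q  ≡⟨ double m q ⟨
    2 ℕ.* ((2 ℕ.* m ℕ.+ 2) ℕ.* q)                <⟨ ℕP.*-monoʳ-< 2 (from8q t) ⟩
    2 ℕ.* 2 ^ m                                  ∎
    where m = t ℕ.+ 8 ℕ.* q

-- tailSum k = Σ_{i ≥ k} i / 2^i. It is opaque because unfolding it makes the conversion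
-- checker evaluate 2 ^ k in unary arithmetic.
opaque
  tailSum : ℕ → ℚ
  tailSum k = (+ (2 ℕ.* k ℕ.+ 2) / 2 ^ k) {{ℕP.m^n≢0 2 k}}

  tailSum-closedForm : ∀ k → tailSum k ≡ (+ (2 ℕ.* k ℕ.+ 2) / 2 ^ k) {{ℕP.m^n≢0 2 k}}
  tailSum-closedForm k = refl

term+tailSum : ∀ k → term k + tailSum (suc k) ≡ tailSum k
term+tailSum k = begin
  term k + tailSum (suc k)                     ≡⟨ cong (_+_ (term k)) (tailSum-closedForm (suc k)) ⟩
  + k / p + + (2 ℕ.* suc k ℕ.+ 2) / (2 ℕ.* p)  ≡⟨ /-+-/ k (2 ℕ.* suc k ℕ.+ 2) p (2 ℕ.* p) ⟩
  + numerator / (p ℕ.* (2 ℕ.* p))              ≡⟨ /-≡-by-cross numerator (2 ℕ.* k ℕ.+ 2) (p ℕ.* (2 ℕ.* p)) p (cross k p) ⟩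
  + (2 ℕ.* k ℕ.+ 2) / p                        ≡⟨ tailSum-closedForm k ⟨
  tailSum k                                    ∎
  where
  open ≡-Reasoning
  p = 2 ^ k
  numerator = k ℕ.* (2 ℕ.* p) ℕ.+ (2 ℕ.* suc k ℕ.+ 2) ℕ.* p
  instance
    _ = ℕP.m^n≢0 2 k
    _ = ℕP.m^n≢0 2 (suc k)
    _ = ℕP.m*n≢0 p (2 ℕ.* p)
  cross : ∀ k p → (k ℕ.* (2 ℕ.* p) ℕ.+ (2 ℕ.* suc k ℕ.+ 2) ℕ.* p) ℕ.* p ≡ (2 ℕ.* k ℕ.+ 2) ℕ.* (p ℕ.* (2 ℕ.* p))
  cross = solve-∀

tailSum-nonNeg : ∀ k → 0ℚ ≤ tailSum k
tailSum-nonNeg k = subst (0ℚ ≤_) (sym (tailSum-closedForm k))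
  (ℚP.nonNegative⁻¹ _ {{ℚP.normalize-nonNeg (2 ℕ.* k ℕ.+ 2) (2 ^ k) {{ℕP.m^n≢0 2 k}}}})

tailSum-vanishes : ∀ ε → 0ℚ < ε → ∃[ K ] (∀ k → K ℕ.≤ k → tailSum k < ε)
tailSum-vanishes ε@(mkℚ (+ suc p) d _) _ = 8 ℕ.* suc d , small
  where
  small : ∀ k → 8 ℕ.* suc d ℕ.≤ k → tailSum k < ε
  small k 8q≤k = subst₂ _<_ (sym (tailSum-closedForm k)) (ℚP.↥p/↧p≡p ε)
    (/-<-by-cross (2 ℕ.* k ℕ.+ 2) (suc p) (2 ^ k) (suc d) {{ℕP.m^n≢0 2 k}}
      (ℕP.<-≤-trans ([2k+2]*q<2^k (suc d) k 8q≤k) (ℕP.m≤m+n (2 ^ k) (p ℕ.* 2 ^ k))))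
tailSum-vanishes (mkℚ (+ zero) _ _)    (ℚ.*<* (ℤ.+<+ ()))
tailSum-vanishes (mkℚ ℤ.-[1+ _ ] _ _) (ℚ.*<* ())

tailSum-decreasing : ∀ k .{{_ : NonZero k}} → tailSum (suc k) < tailSum k
tailSum-decreasing k = subst₂ _<_ (ℚP.+-identityˡ (tailSum (suc k))) (term+tailSum k)
  (ℚP.+-monoˡ-< (tailSum (suc k)) (ℚP.positive⁻¹ (term k) {{ℚP.normalize-pos k (2 ^ k) {{ℕP.m^n≢0 2 k}}}}))

listSum : List ℕ → ℚ
listSum []       = 0ℚ
listSum (a ∷ as) = term a + listSum as

prefixed : List ℕ → ℕ → ℕ → ℕ
prefixed []       N i       = i ℕ.+ N
prefixed (a ∷ as) N zero    = a
prefixed (a ∷ as) N (suc i) = prefixed as N i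

partialSum-suc : ∀ a n → partialSum a (suc n) ≡ term (a 0) + partialSum (a ∘ suc) n
partialSum-suc a zero    = trans (ℚP.+-identityˡ (term (a 0))) (sym (ℚP.+-identityʳ (term (a 0))))
partialSum-suc a (suc n) = begin
  partialSum a (suc n) + term (a (suc n))                   ≡⟨ cong (_+ term (a (suc n))) (partialSum-suc a n) ⟩
  term (a 0) + partialSum (a ∘ suc) n + term (a (suc n))    ≡⟨ ℚP.+-assoc (term (a 0)) (partialSum (a ∘ suc) n) (term (a (suc n))) ⟩
  term (a 0) + (partialSum (a ∘ suc) n + term (a (suc n)))  ∎
  where open ≡-Reasoning

partialSum-from+tailSum : ∀ N m → partialSum (ℕ._+ N) m + tailSum (m ℕ.+ N) ≡ tailSum N
partialSum-from+tailSum N zero    = ℚP.+-identityˡ (tailSum N)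
partialSum-from+tailSum N (suc m) = begin
  P + term (m ℕ.+ N) + tailSum (suc m ℕ.+ N)    ≡⟨ ℚP.+-assoc P (term (m ℕ.+ N)) (tailSum (suc m ℕ.+ N)) ⟩
  P + (term (m ℕ.+ N) + tailSum (suc m ℕ.+ N))  ≡⟨ cong (_+_ P) (term+tailSum (m ℕ.+ N)) ⟩
  P + tailSum (m ℕ.+ N)                         ≡⟨ partialSum-from+tailSum N m ⟩
  tailSum N                                     ∎
  where
  open ≡-Reasoning
  P = partialSum (ℕ._+ N) m

partialSum-prefixed : ∀ F N m →
  partialSum (prefixed F N) (length F ℕ.+ m) + tailSum (m ℕ.+ N) ≡ listSum F + tailSum N
partialSum-prefixed []      N m = trans (partialSum-from+tailSum N m) (sym (ℚP.+-identityˡ (tailSum N)))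
partialSum-prefixed (a ∷ F) N m = begin
  partialSum (prefixed (a ∷ F) N) (suc (length F ℕ.+ m)) + tailSum (m ℕ.+ N)
    ≡⟨ cong (_+ tailSum (m ℕ.+ N)) (partialSum-suc (prefixed (a ∷ F) N) (length F ℕ.+ m)) ⟩
  term a + P + tailSum (m ℕ.+ N)
    ≡⟨ ℚP.+-assoc (term a) P (tailSum (m ℕ.+ N)) ⟩
  term a + (P + tailSum (m ℕ.+ N))
    ≡⟨ cong (_+_ (term a)) (partialSum-prefixed F N m) ⟩
  term a + (listSum F + tailSum N)
    ≡⟨ ℚP.+-assoc (term a) (listSum F) (tailSum N) ⟨
  term a + listSum F + tailSum N
    ∎
  where
  open ≡-Reasoning
  P = partialSum (prefixed F N) (length F ℕ.+ m)

prefixed-sumsTo : ∀ F N → SeriesSumsTo (prefixed F N) (listSum F + tailSum N)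
prefixed-sumsTo F N ε ε>0 with tailSum-vanishes ε ε>0
... | K , small = length F ℕ.+ K , close
  where
  distance : ℕ → ℚ
  distance n = ∣ partialSum (prefixed F N) n - (listSum F + tailSum N) ∣
  close : ∀ n → length F ℕ.+ K ℕ.≤ n → distance n < ε
  close n le with ℕP.m≤n⇒∃[o]m+o≡n le
  ... | o , refl = subst (λ n → distance n < ε) (sym (ℕP.+-assoc (length F) K o))
    (subst (_< ε) (sym (p+q≡r⇒∣p-r∣≡q {partialSum (prefixed F N) (length F ℕ.+ (K ℕ.+ o))}
                                       (partialSum-prefixed F N (K ℕ.+ o)) (tailSum-nonNeg (K ℕ.+ o ℕ.+ N))))
      (small (K ℕ.+ o ℕ.+ N) (ℕP.≤-trans (ℕP.m≤m+n K o) (ℕP.m≤m+n (K ℕ.+ o) N))))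

Linked-∷ʳ-mono : ∀ {M N} xs → Linked ℕ._<_ (xs ∷ʳ M) → M ℕ.≤ N → Linked ℕ._<_ (xs ∷ʳ N)
Linked-∷ʳ-mono []           _              M≤N = [-]
Linked-∷ʳ-mono (x ∷ [])     (x<M ∷ [-])    M≤N = ℕP.<-≤-trans x<M M≤N ∷ [-]
Linked-∷ʳ-mono (x ∷ y ∷ xs) (x<y ∷ linked) M≤N = x<y ∷ Linked-∷ʳ-mono (y ∷ xs) linked M≤N

head<last : ∀ {x y} xs → Linked ℕ._<_ (x ∷ (xs ∷ʳ y)) → x ℕ.< y
head<last []       (x<y ∷ [-])    = x<y
head<last (_ ∷ xs) (x<z ∷ linked) = ℕP.<-trans x<z (head<last xs linked)

prefixed-increasing : ∀ {N} F → Linked ℕ._<_ (F ∷ʳ N) → ∀ i → prefixed F N i ℕ.< prefixed F N (suc i)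
prefixed-increasing []          _           i       = ℕP.n<1+n _
prefixed-increasing (a ∷ [])    (a<N ∷ [-]) zero    = a<N
prefixed-increasing (a ∷ b ∷ F) (a<b ∷ _)   zero    = a<b
prefixed-increasing (a ∷ F)     linked      (suc i) = prefixed-increasing F (Linked.tail linked) i

prefixed-strictlyIncPos : ∀ {N} F → Linked ℕ._<_ (0 ∷ (F ∷ʳ N)) → StrictlyIncPos (prefixed F N)
prefixed-strictlyIncPos F linked =
  prefixed-increasing (0 ∷ F) linked 0 , prefixed-increasing F (Linked.tail linked)

prefixed-differ : ∀ {N} F G → Linked ℕ._<_ (F ∷ʳ N) → Linked ℕ._<_ (G ∷ʳ N) →
                  F ≢ G → Differ (prefixed F N) (prefixed G N)
prefixed-differ []      []      _  _  F≢G = ⊥-elim (F≢G refl)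
prefixed-differ []      (b ∷ G) _  lG _   = 0 , λ N≡b → ℕP.<-irrefl (sym N≡b) (head<last G lG)
prefixed-differ (a ∷ F) []      lF _  _   = 0 , λ a≡N → ℕP.<-irrefl a≡N (head<last F lF)
prefixed-differ (a ∷ F) (b ∷ G) lF lG F≢G with a ℕP.≟ b
... | no a≢b  = 0 , a≢b
... | yes refl with prefixed-differ F G (Linked.tail lF) (Linked.tail lG) (F≢G ∘ cong (a ∷_))
...   | i , differ = suc i , differ

prefixes : Fin 9 → List ℕ
prefixes = Vec.lookup
  ( (4 ∷ 5 ∷ 7 ∷ 8 ∷ 9 ∷ 11 ∷ 13 ∷ 14 ∷ [])
  Vec.∷ (4 ∷ 5 ∷ 6 ∷ 10 ∷ 11 ∷ 13 ∷ 14 ∷ [])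
  Vec.∷ (2 ∷ 10 ∷ 11 ∷ 13 ∷ 14 ∷ [])
  Vec.∷ (1 ∷ 10 ∷ 11 ∷ 13 ∷ 14 ∷ [])
  Vec.∷ (3 ∷ 6 ∷ 8 ∷ 10 ∷ 11 ∷ 13 ∷ 14 ∷ [])
  Vec.∷ (4 ∷ 5 ∷ 6 ∷ 9 ∷ [])
  Vec.∷ (2 ∷ 9 ∷ [])
  Vec.∷ (1 ∷ 9 ∷ [])
  Vec.∷ (3 ∷ 6 ∷ 8 ∷ 9 ∷ [])
  Vec.∷ Vec.[])

S : ℚ
S = listSum (prefixes Fin.zero)

prefixes-valid : ∀ j → Linked ℕ._<_ (0 ∷ (prefixes j ∷ʳ 15))
prefixes-valid = toWitness {a? = FinP.all? λ j →
  Linked.linked? ℕP._<?_ (0 ∷ (prefixes j ∷ʳ 15))} _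

prefixes-sum : ∀ j → listSum (prefixes j) ≡ S
prefixes-sum = toWitness {a? = FinP.all? λ j → listSum (prefixes j) ℚP.≟ S} _

prefixes-distinct : ∀ j k → j ≢ k → prefixes j ≢ prefixes k
prefixes-distinct = toWitness {a? = FinP.all? λ j → FinP.all? λ k →
  ¬? (j FinP.≟ k) →-dec ¬? (ListP.≡-dec ℕP._≟_ (prefixes j) (prefixes k))} _

nineRepresentations : ∀ N → 15 ℕ.≤ N → HasNineReps (S + tailSum N)
nineRepresentations N 15≤N = (λ j → prefixed (prefixes j) N) , isRepresentation , differ
  where
  valid : ∀ j → Linked ℕ._<_ (0 ∷ (prefixes j ∷ʳ N))
  valid j = Linked-∷ʳ-mono (0 ∷ prefixes j) (prefixes-valid j) 15≤N
  isRepresentation : ∀ j → IsRepresentation (S + tailSum N) (prefixed (prefixes j) N)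
  isRepresentation j = prefixed-strictlyIncPos (prefixes j) (valid j)
    , subst (SeriesSumsTo (prefixed (prefixes j) N)) (cong (_+ tailSum N) (prefixes-sum j))
            (prefixed-sumsTo (prefixes j) N)
  differ : ∀ j k → j ≢ k → Differ (prefixed (prefixes j) N) (prefixed (prefixes k) N)
  differ j k j≢k = prefixed-differ (prefixes j) (prefixes k)
    (Linked.tail (valid j)) (Linked.tail (valid k)) (prefixes-distinct j k j≢k)

S+tailSum-injective : ∀ {m n} → S + tailSum (15 ℕ.+ m) ≡ S + tailSum (15 ℕ.+ n) → m ≡ n
S+tailSum-injective {m} {n} eq =
  strictlyDecreasing⇒injective (λ n → tailSum (15 ℕ.+ n)) (λ n → tailSum-decreasing (15 ℕ.+ n))
    (+-cancelˡ S (tailSum (15 ℕ.+ m)) (tailSum (15 ℕ.+ n)) eq)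

corollary3p6 : InfinitelyMany HasNineReps
corollary3p6 xs = avoidingWitness (injective⇒avoids ℚP._≟_ x S+tailSum-injective xs)
  where
  x : ℕ → ℚ
  x n = S + tailSum (15 ℕ.+ n)
  avoidingWitness : ∃[ n ] x n ∉ xs → ∃[ y ] (y ∉ xs × HasNineReps y)
  avoidingWitness (n , x∉xs) = x n , x∉xs , nineRepresentations (15 ℕ.+ n) (ℕP.m≤m+n 15 n)
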